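{- There is no linear code $C\subseteq\mathbb{F}_5^{13}$ of dimension $4$ such that every nonzero codeword of $C$ has Hamming weight $7$, $10$, or $12$.
   Context: The Hamming weight of a vector is its number of nonzero coordinates. -}

module Defs where

open import Data.Nat using (ℕ; zero; suc) renaming (_+_ to _+ℕ_; _*_ to _*ℕ_)
open import Data.Nat.DivMod using (_mod_)
open import Data.Fin using (Fin; toℕ) renaming (zero to fzero; suc to fsuc)
open import Data.Product using (Σ; _×_)
open import Relation.Binary.PropositionalEquality using (_≡_)
open import Relation.Nullary using (¬_; Dec; yes; no)
open import Data.Fin.Properties using (_≟_)

F₅ : Set
F₅ = Fin 5

0F : F₅
0F = fzero

_+F_ : F₅ → F₅ → F₅
a +F b = (toℕ a +ℕ toℕ b) mod 5

_*F_ : F₅ → F₅ → F₅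
a *F b = (toℕ a *ℕ toℕ b) mod 5

Word : ℕ → Set
Word n = Fin n → F₅

zeroW : ∀ {n} → Word n
zeroW _ = 0F

_+W_ : ∀ {n} → Word n → Word n → Word n
(x +W y) j = x j +F y j

_·W_ : ∀ {n} → F₅ → Word n → Word n
(a ·W x) j = a *F x j

_≈W_ : ∀ {n} → Word n → Word n → Set
x ≈W y = ∀ j → x j ≡ y j

lincomb : ∀ {n} k → (Fin k → F₅) → (Fin k → Word n) → Word n
lincomb zero    c b = zeroW
lincomb (suc k) c b = (c fzero ·W b fzero) +W lincomb k (λ i → c (fsuc i)) (λ i → b (fsuc i))

weight : ∀ {n} → Word n → ℕ
weight {zero}  x = 0
weight {suc n} x with x fzero ≟ 0F
... | yes _ = weight {n} (λ j → x (fsuc j))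
... | no  _ = suc (weight {n} (λ j → x (fsuc j)))

record LinearCode (n k : ℕ) : Set₁ where
  field
    _∈C       : Word n → Set
    ∈-resp    : ∀ {x y} → x ≈W y → x ∈C → y ∈C
    zero∈     : zeroW ∈C
    +-closed  : ∀ {x y} → x ∈C → y ∈C → (x +W y) ∈C
    ·-closed  : ∀ a {x} → x ∈C → (a ·W x) ∈C
    basis     : Fin k → Word n
    basis∈    : ∀ i → basis i ∈C
    basis-indep : ∀ (c : Fin k → F₅) → lincomb k c basis ≈W zeroW → ∀ i → c i ≡ 0F
    basis-span  : ∀ x → x ∈C → Σ (Fin k → F₅) (λ c → x ≈W lincomb k c basis)

{-# OPTIONS --safe #-}
module Submission where

-- Gaussian elimination on a basis gives two independent codewords x, y
-- vanishing on the first two coordinates, so their joint support has some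
-- size s ≤ 11 and the 24 nonzero words a x + b y all have weight 7 or 10.
-- Each coordinate of the joint support is nonzero in exactly 20 of the 25
-- words a x + b y, so their weights sum to 20 s.  Since 7 ≡ 10 ≡ 1 (mod 3),
-- that sum is ≡ 24 ≡ 0, hence 3 ∣ s and s ≤ 9; then no word has weight 10,
-- and 24 · 7 = 168 is not a multiple of 20.

open import Defs
open import Data.Nat using (ℕ; zero; suc; _+_; _*_; _≤_; _⊔_; _%_; NonZero; z≤n; s≤s)
open import Data.Nat.Properties
  using (+-mono-≤; ≤-trans; ≤-reflexive; ≤-pred; ⊔-lub; m≤n⇒m<n∨m≡n; *-comm; +-0-commutativeMonoid; +-*-semiring)
  renaming (_≟_ to _≟ℕ_; _≤?_ to _≤?ℕ_)
open import Data.Nat.DivMod using (%-distribˡ-+; m*n%n≡0)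
open import Data.Fin using (Fin) renaming (zero to fzero; suc to fsuc)
open import Data.Fin.Properties using (_≟_; all?; any?)
open import Data.Vec.Functional using ([]; _∷_; head; tail)
open import Data.Product using (∃; _×_; _,_; proj₁; proj₂)
open import Data.Sum using (_⊎_; inj₁; inj₂)
open import Data.Empty using (⊥)
open import Function using (_∘_)
open import Relation.Nullary using (¬_; yes; no; contradiction)
open import Relation.Nullary.Decidable using (from-yes; ¬?; _→-dec_)
open import Relation.Binary.PropositionalEquality
  using (_≡_; _≢_; refl; sym; trans; cong; cong₂; module ≡-Reasoning)
open import Algebra.Properties.CommutativeMonoid.Sum +-0-commutativeMonoid
  using (sum; sum-syntax; sum-cong-≗; ∑-comm)
open import Algebra.Properties.Semiring.Sum +-*-semiring using (*-distribˡ-sum)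

1F : F₅
1F = fsuc fzero

+F-comm : ∀ a b → a +F b ≡ b +F a
+F-comm = from-yes (all? λ a → all? λ b → a +F b ≟ b +F a)

+F-identityˡ : ∀ a → 0F +F a ≡ a
+F-identityˡ = from-yes (all? λ a → 0F +F a ≟ a)

+F-identityʳ : ∀ a → a +F 0F ≡ a
+F-identityʳ = from-yes (all? λ a → a +F 0F ≟ a)

+F-interchange : ∀ p q r s → (p +F q) +F (r +F s) ≡ (p +F r) +F (q +F s)
+F-interchange = from-yes (all? λ p → all? λ q → all? λ r → all? λ s →
  (p +F q) +F (r +F s) ≟ (p +F r) +F (q +F s))

*F-identityˡ : ∀ a → 1F *F a ≡ a
*F-identityˡ = from-yes (all? λ a → 1F *F a ≟ a)

*F-zeroʳ : ∀ a → a *F 0F ≡ 0F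
*F-zeroʳ = from-yes (all? λ a → a *F 0F ≟ 0F)

*F-assoc : ∀ a b c → (a *F b) *F c ≡ a *F (b *F c)
*F-assoc = from-yes (all? λ a → all? λ b → all? λ c → (a *F b) *F c ≟ a *F (b *F c))

*F-distribˡ-+F : ∀ a b c → a *F (b +F c) ≡ (a *F b) +F (a *F c)
*F-distribˡ-+F = from-yes (all? λ a → all? λ b → all? λ c → a *F (b +F c) ≟ (a *F b) +F (a *F c))

*F-distribʳ-+F : ∀ a b c → (a +F b) *F c ≡ (a *F c) +F (b *F c)
*F-distribʳ-+F = from-yes (all? λ a → all? λ b → all? λ c → (a +F b) *F c ≟ (a *F c) +F (b *F c))

cancelling-multiplier : ∀ x y → y ≢ 0F → ∃ λ t → x +F (t *F y) ≡ 0F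
cancelling-multiplier = from-yes (all? λ x → all? λ y →
  ¬? (y ≟ 0F) →-dec any? λ t → x +F (t *F y) ≟ 0F)

χ≢0 : F₅ → ℕ
χ≢0 fzero    = 0
χ≢0 (fsuc _) = 1

χ≢0-≢0 : ∀ {a} → a ≢ 0F → χ≢0 a ≡ 1
χ≢0-≢0 {fzero}  a≢0 = contradiction refl a≢0
χ≢0-≢0 {fsuc _} _   = refl

χ≢0-⊔-≤1 : ∀ p q → χ≢0 p ⊔ χ≢0 q ≤ 1
χ≢0-⊔-≤1 p q = ⊔-lub (χ≢0-≤1 p) (χ≢0-≤1 q)
  where
    χ≢0-≤1 : ∀ a → χ≢0 a ≤ 1
    χ≢0-≤1 fzero    = z≤n
    χ≢0-≤1 (fsuc _) = s≤s z≤n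

-- (a *F p) +F ((b *F q) +F 0F) is how a coordinate of lincomb 2 (a ∷ b ∷ []) unfolds.
χ≢0-combination-≤ : ∀ a b p q → χ≢0 ((a *F p) +F ((b *F q) +F 0F)) ≤ χ≢0 p ⊔ χ≢0 q
χ≢0-combination-≤ = from-yes (all? λ a → all? λ b → all? λ p → all? λ q →
  χ≢0 ((a *F p) +F ((b *F q) +F 0F)) ≤?ℕ χ≢0 p ⊔ χ≢0 q)

nonzero-combinations-count : ∀ p q →
  ∑[ a < 5 ] ∑[ b < 5 ] χ≢0 ((a *F p) +F ((b *F q) +F 0F)) ≡ 20 * (χ≢0 p ⊔ χ≢0 q)
nonzero-combinations-count = from-yes (all? λ p → all? λ q →
  ∑[ a < 5 ] ∑[ b < 5 ] χ≢0 ((a *F p) +F ((b *F q) +F 0F)) ≟ℕ 20 * (χ≢0 p ⊔ χ≢0 q))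

sum-mono-≤ : ∀ {k} {f g : Fin k → ℕ} → (∀ i → f i ≤ g i) → sum f ≤ sum g
sum-mono-≤ {zero}  _   = z≤n
sum-mono-≤ {suc k} f≤g = +-mono-≤ (f≤g fzero) (sum-mono-≤ (f≤g ∘ fsuc))

sum-≤-length : ∀ {k} {f : Fin k → ℕ} → (∀ i → f i ≤ 1) → sum f ≤ k
sum-≤-length {zero}  _    = z≤n
sum-≤-length {suc k} f≤1 = +-mono-≤ (f≤1 fzero) (sum-≤-length (f≤1 ∘ fsuc))

sum-cong-mod : ∀ {k} m .{{_ : NonZero m}} (f g : Fin k → ℕ) →
  (∀ i → f i % m ≡ g i % m) → sum f % m ≡ sum g % m
sum-cong-mod {zero}  m f g f≡g = refl
sum-cong-mod {suc k} m f g f≡g = begin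
  (f fzero + sum (tail f)) % m
    ≡⟨ %-distribˡ-+ (f fzero) _ m ⟩
  (f fzero % m + sum (tail f) % m) % m
    ≡⟨ cong (_% m) (cong₂ _+_ (f≡g fzero) (sum-cong-mod m (tail f) (tail g) (f≡g ∘ fsuc))) ⟩
  (g fzero % m + sum (tail g) % m) % m
    ≡⟨ %-distribˡ-+ (g fzero) _ m ⟨
  (g fzero + sum (tail g)) % m ∎
  where open ≡-Reasoning

weight≡∑χ≢0 : ∀ {n} (x : Word n) → weight x ≡ ∑[ j < n ] χ≢0 (x j)
weight≡∑χ≢0 {zero}  x = refl
weight≡∑χ≢0 {suc n} x with x fzero ≟ 0F
... | yes x₀≡0 rewrite x₀≡0 = weight≡∑χ≢0 (tail x)
... | no  x₀≢0 = cong₂ _+_ (sym (χ≢0-≢0 x₀≢0)) (weight≡∑χ≢0 (tail x))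

IsZero : ∀ {k} → (Fin k → F₅) → Set
IsZero c = ∀ i → c i ≡ 0F

Independent : ∀ {n} k → (Fin k → Word n) → Set
Independent k w = ∀ c → lincomb k c w ≈W zeroW → IsZero c

dot : ∀ k → (Fin k → F₅) → (Fin k → F₅) → F₅
dot zero    a t = 0F
dot (suc k) a t = (head a *F head t) +F dot k (tail a) (tail t)

unit : ∀ {k} → Fin k → Fin k → F₅
unit fzero    fzero     = 1F
unit fzero    (fsuc _)  = 0F
unit (fsuc _) fzero     = 0F
unit (fsuc i) (fsuc i₁) = unit i i₁

lincomb-zero : ∀ {n} k (w : Fin k → Word n) → lincomb k (λ _ → 0F) w ≈W zeroW
lincomb-zero zero    w j = refl
lincomb-zero (suc k) w j rewrite lincomb-zero k (tail w) j = refl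

lincomb-unit : ∀ {n} k (w : Fin k → Word n) i → lincomb k (unit i) w ≈W w i
lincomb-unit (suc k) w fzero j rewrite lincomb-zero k (tail w) j =
  trans (+F-identityʳ _) (*F-identityˡ _)
lincomb-unit (suc k) w (fsuc i) j = trans (+F-identityˡ _) (lincomb-unit k (tail w) i j)

lincomb-vanishing : ∀ {n} k c (w : Fin k → Word n) j → (∀ i → w i j ≡ 0F) → lincomb k c w j ≡ 0F
lincomb-vanishing zero    c w j _ = refl
lincomb-vanishing (suc k) c w j wⱼ≡0
  rewrite wⱼ≡0 fzero | lincomb-vanishing k (tail c) (tail w) j (wⱼ≡0 ∘ fsuc) | *F-zeroʳ (head c) = refl

lincomb-+W : ∀ {n} k a (u v : Fin k → Word n) →
  lincomb k a (λ i → u i +W v i) ≈W (lincomb k a u +W lincomb k a v)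
lincomb-+W zero    a u v j = refl
lincomb-+W (suc k) a u v j =
  trans (cong₂ _+F_ (*F-distribˡ-+F (head a) (u fzero j) (v fzero j)) (lincomb-+W k (tail a) (tail u) (tail v) j))
        (+F-interchange (head a *F u fzero j) (head a *F v fzero j)
                        (lincomb k (tail a) (tail u) j) (lincomb k (tail a) (tail v) j))

lincomb-scaled : ∀ {n} k a t (z : Word n) → lincomb k a (λ i → t i ·W z) ≈W (dot k a t ·W z)
lincomb-scaled zero    a t z j = refl
lincomb-scaled (suc k) a t z j = begin
  (head a *F (head t *F z j)) +F lincomb k (tail a) (λ i → tail t i ·W z) j
    ≡⟨ cong₂ _+F_ (sym (*F-assoc (head a) (head t) (z j))) (lincomb-scaled k (tail a) (tail t) z j) ⟩
  ((head a *F head t) *F z j) +F (dot k (tail a) (tail t) *F z j)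
    ≡⟨ *F-distribʳ-+F (head a *F head t) (dot k (tail a) (tail t)) (z j) ⟨
  dot (suc k) a t *F z j ∎
  where open ≡-Reasoning

-- v ≼ w: v is spanned by w through a coefficient map that reflects zero,
-- which is what lets independence pass from w to v.
record _≼_ {n m k} (v : Fin m → Word n) (w : Fin k → Word n) : Set where
  field
    coeffs              : (Fin m → F₅) → (Fin k → F₅)
    lincomb-coeffs      : ∀ a → lincomb m a v ≈W lincomb k (coeffs a) w
    coeffs-reflect-zero : ∀ a → IsZero (coeffs a) → IsZero a

open _≼_

≼-trans : ∀ {n l m k} {u : Fin l → Word n} {v : Fin m → Word n} {w : Fin k → Word n} →
  u ≼ v → v ≼ w → u ≼ w
≼-trans u≼v v≼w = record
  { coeffs              = coeffs v≼w ∘ coeffs u≼v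
  ; lincomb-coeffs      = λ a j → trans (lincomb-coeffs u≼v a j) (lincomb-coeffs v≼w (coeffs u≼v a) j)
  ; coeffs-reflect-zero = λ a → coeffs-reflect-zero u≼v a ∘ coeffs-reflect-zero v≼w (coeffs u≼v a)
  }

≼-extend : ∀ {n m k} {v : Fin m → Word n} {w : Fin (suc k) → Word n} →
  v ≼ tail w → (head w ∷ v) ≼ w
≼-extend {w = w} v≼w = record
  { coeffs              = λ a → head a ∷ coeffs v≼w (tail a)
  ; lincomb-coeffs      = λ a j → cong ((head a *F head w j) +F_) (lincomb-coeffs v≼w (tail a) j)
  ; coeffs-reflect-zero = λ { a c≡0 fzero    → c≡0 fzero
                            ; a c≡0 (fsuc i) → coeffs-reflect-zero v≼w (tail a) (c≡0 ∘ fsuc) i }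
  }

≼-independent : ∀ {n m k} {v : Fin m → Word n} {w : Fin k → Word n} →
  v ≼ w → Independent k w → Independent m v
≼-independent v≼w w-indep a a·v≈0 = coeffs-reflect-zero v≼w a
  (w-indep (coeffs v≼w a) λ j → trans (sym (lincomb-coeffs v≼w a j)) (a·v≈0 j))

≼-span : ∀ {n m k} {v : Fin m → Word n} {w : Fin k → Word n} →
  (v≼w : v ≼ w) → ∀ i → v i ≈W lincomb k (coeffs v≼w (unit i)) w
≼-span {m = m} {v = v} v≼w i j = trans (sym (lincomb-unit m v i j)) (lincomb-coeffs v≼w (unit i) j)

≼-vanishing : ∀ {n m k} {v : Fin m → Word n} {w : Fin k → Word n} {j} →
  v ≼ w → (∀ i → w i j ≡ 0F) → ∀ i → v i j ≡ 0F
≼-vanishing {k = k} {w = w} {j} v≼w wⱼ≡0 i =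
  trans (≼-span v≼w i j) (lincomb-vanishing k (coeffs v≼w (unit i)) w j wⱼ≡0)

module _ {n k : ℕ} (C : LinearCode n k) where
  open LinearCode C

  lincomb-∈ : ∀ m c (w : Fin m → Word n) → (∀ i → w i ∈C) → lincomb m c w ∈C
  lincomb-∈ zero    c w w∈C = zero∈
  lincomb-∈ (suc m) c w w∈C =
    +-closed (·-closed (head c) (w∈C fzero)) (lincomb-∈ m (tail c) (tail w) (w∈C ∘ fsuc))

  ≼-∈ : ∀ {m l} {v : Fin m → Word n} {w : Fin l → Word n} → v ≼ w → (∀ i → w i ∈C) → ∀ i → v i ∈C
  ≼-∈ {l = l} {w = w} v≼w w∈C i =
    ∈-resp (λ j → sym (≼-span v≼w i j)) (lincomb-∈ l (coeffs v≼w (unit i)) w w∈C)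

record Elimination {n m} (w : Fin (suc m) → Word n) (j : Fin n) : Set where
  field
    reduced          : Fin m → Word n
    reduced-vanishes : ∀ i → reduced i j ≡ 0F
    reduced≼         : reduced ≼ w

open Elimination

eliminate-at-pivot : ∀ {n m} (w : Fin (suc m) → Word n) {j} → w fzero j ≢ 0F → Elimination w j
eliminate-at-pivot {m = m} w {j} w₀ⱼ≢0 = record
  { reduced          = v
  ; reduced-vanishes = proj₂ ∘ multiplier
  ; reduced≼         = record
    { coeffs              = λ a → dot m a t ∷ a
    ; lincomb-coeffs      = combination
    ; coeffs-reflect-zero = λ a c≡0 → c≡0 ∘ fsuc
    }
  }
  where
    open ≡-Reasoning
    multiplier : ∀ i → ∃ λ t → w (fsuc i) j +F (t *F w fzero j) ≡ 0F
    multiplier i = cancelling-multiplier (w (fsuc i) j) (w fzero j) w₀ⱼ≢0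
    t : Fin m → F₅
    t = proj₁ ∘ multiplier
    v : Fin m → Word _
    v i = w (fsuc i) +W (t i ·W w fzero)
    combination : ∀ a → lincomb m a v ≈W lincomb (suc m) (dot m a t ∷ a) w
    combination a j₁ = begin
      lincomb m a v j₁
        ≡⟨ lincomb-+W m a (tail w) (λ i → t i ·W w fzero) j₁ ⟩
      lincomb m a (tail w) j₁ +F lincomb m a (λ i → t i ·W w fzero) j₁
        ≡⟨ cong (lincomb m a (tail w) j₁ +F_) (lincomb-scaled m a t (w fzero) j₁) ⟩
      lincomb m a (tail w) j₁ +F (dot m a t *F w fzero j₁)
        ≡⟨ +F-comm (lincomb m a (tail w) j₁) (dot m a t *F w fzero j₁) ⟩
      lincomb (suc m) (dot m a t ∷ a) w j₁ ∎

eliminate : ∀ {n m} (w : Fin (suc m) → Word n) (j : Fin n) → Elimination w j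
eliminate w j with w fzero j ≟ 0F
... | no w₀ⱼ≢0 = eliminate-at-pivot w w₀ⱼ≢0
eliminate {m = zero} w j | yes _ = record
  { reduced          = []
  ; reduced-vanishes = λ ()
  ; reduced≼         = record
    { coeffs              = λ _ _ → 0F
    ; lincomb-coeffs      = λ _ _ → refl
    ; coeffs-reflect-zero = λ _ _ ()
    }
  }
eliminate {m = suc m} w j | yes w₀ⱼ≡0 = record
  { reduced          = w fzero ∷ reduced rest
  ; reduced-vanishes = λ { fzero → w₀ⱼ≡0 ; (fsuc i) → reduced-vanishes rest i }
  ; reduced≼         = ≼-extend (reduced≼ rest)
  }
  where
    rest = eliminate (tail w) j

plane : ∀ {n} → (Fin 2 → Word n) → F₅ → F₅ → Word n
plane u a b = lincomb 2 (a ∷ b ∷ []) u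

jointSupportSize : ∀ {n} → (Fin 2 → Word n) → ℕ
jointSupportSize {n} u = ∑[ j < n ] (χ≢0 (u fzero j) ⊔ χ≢0 (u (fsuc fzero) j))

plane-≉0 : ∀ {n} {u : Fin 2 → Word n} → Independent 2 u →
  ∀ {a b} → (a , b) ≢ (0F , 0F) → ¬ (plane u a b ≈W zeroW)
plane-≉0 u-indep {a} {b} ab≢0 ab·u≈0 =
  ab≢0 (cong₂ _,_ (u-indep (a ∷ b ∷ []) ab·u≈0 fzero) (u-indep (a ∷ b ∷ []) ab·u≈0 (fsuc fzero)))

weight-plane-≤ : ∀ {n} (u : Fin 2 → Word n) a b → weight (plane u a b) ≤ jointSupportSize u
weight-plane-≤ u a b = ≤-trans (≤-reflexive (weight≡∑χ≢0 (plane u a b)))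
  (sum-mono-≤ λ j → χ≢0-combination-≤ a b (u fzero j) (u (fsuc fzero) j))

∑∑weight-plane : ∀ {n} (u : Fin 2 → Word n) →
  ∑[ a < 5 ] ∑[ b < 5 ] weight (plane u a b) ≡ 20 * jointSupportSize u
∑∑weight-plane {n} u = begin
  ∑[ a < 5 ] ∑[ b < 5 ] weight (plane u a b)
    ≡⟨ sum-cong-≗ (λ a → sum-cong-≗ λ b → weight≡∑χ≢0 (plane u a b)) ⟩
  ∑[ a < 5 ] ∑[ b < 5 ] ∑[ j < n ] χ≢0 (plane u a b j)
    ≡⟨ sum-cong-≗ (λ a → ∑-comm λ b j → χ≢0 (plane u a b j)) ⟩
  ∑[ a < 5 ] ∑[ j < n ] ∑[ b < 5 ] χ≢0 (plane u a b j)
    ≡⟨ ∑-comm (λ a j → ∑[ b < 5 ] χ≢0 (plane u a b j)) ⟩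
  ∑[ j < n ] ∑[ a < 5 ] ∑[ b < 5 ] χ≢0 (plane u a b j)
    ≡⟨ sum-cong-≗ (λ j → nonzero-combinations-count (u fzero j) (u (fsuc fzero) j)) ⟩
  ∑[ j < n ] (20 * (χ≢0 (u fzero j) ⊔ χ≢0 (u (fsuc fzero) j)))
    ≡⟨ *-distribˡ-sum 20 (λ j → χ≢0 (u fzero j) ⊔ χ≢0 (u (fsuc fzero) j)) ⟨
  20 * jointSupportSize u ∎
  where open ≡-Reasoning

jointSupportSize-≤ : ∀ {n} (u : Fin 2 → Word (suc (suc n))) →
  (∀ i → u i fzero ≡ 0F) → (∀ i → u i (fsuc fzero) ≡ 0F) → jointSupportSize u ≤ n
jointSupportSize-≤ u u₀≡0 u₁≡0 = ≤-trans (≤-reflexive leading-zeros)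
  (sum-≤-length λ j → χ≢0-⊔-≤1 (u fzero (fsuc (fsuc j))) (u (fsuc fzero) (fsuc (fsuc j))))
  where
    occupied : Fin _ → ℕ
    occupied j = χ≢0 (u fzero j) ⊔ χ≢0 (u (fsuc fzero) j)
    unoccupied : ∀ {j} → (∀ i → u i j ≡ 0F) → occupied j ≡ 0
    unoccupied uⱼ≡0 = cong₂ (λ p q → χ≢0 p ⊔ χ≢0 q) (uⱼ≡0 fzero) (uⱼ≡0 (fsuc fzero))
    leading-zeros : jointSupportSize u ≡ sum (occupied ∘ fsuc ∘ fsuc)
    leading-zeros = cong₂ (λ p q → p + (q + sum (occupied ∘ fsuc ∘ fsuc))) (unoccupied u₀≡0) (unoccupied u₁≡0)

pair-cases : ∀ a b → (a , b) ≡ (0F , 0F) ⊎ ((a , b) ≢ (0F , 0F) × χ≢0 a ⊔ χ≢0 b ≡ 1)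
pair-cases fzero    fzero    = inj₁ refl
pair-cases fzero    (fsuc _) = inj₂ ((λ ()) , refl)
pair-cases (fsuc _) fzero    = inj₂ ((λ ()) , refl)
pair-cases (fsuc _) (fsuc _) = inj₂ ((λ ()) , refl)

≤11⇒[20*s]%3≡0⇒≤9 : ∀ {s} → s ≤ 11 → (20 * s) % 3 ≡ 0 → s ≤ 9
≤11⇒[20*s]%3≡0⇒≤9 s≤11 3∣20s with m≤n⇒m<n∨m≡n s≤11
... | inj₂ refl = contradiction 3∣20s λ ()
... | inj₁ s<11 with m≤n⇒m<n∨m≡n (≤-pred s<11)
...   | inj₁ s<10 = ≤-pred s<10
...   | inj₂ refl = contradiction 3∣20s λ ()

20∤168 : ∀ s → 168 ≢ 20 * s
20∤168 s 168≡20s = contradiction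
  (trans (cong (_% 20) 168≡20s) (trans (cong (_% 20) (*-comm 20 s)) (m*n%n≡0 s 20))) λ ()

weights-7-10-12-impossible : (W : F₅ → F₅ → ℕ) (s : ℕ) → s ≤ 11 → W 0F 0F ≡ 0 →
  (∀ a b → (a , b) ≢ (0F , 0F) → W a b ≡ 7 ⊎ W a b ≡ 10 ⊎ W a b ≡ 12) →
  (∀ a b → W a b ≤ s) → ∑[ a < 5 ] ∑[ b < 5 ] W a b ≡ 20 * s → ⊥
weights-7-10-12-impossible W s s≤11 W₀₀≡0 allowed W≤s ∑W≡20s =
  20∤168 s (trans (sym (sum-cong-≗ λ a → sum-cong-≗ (W≡7χ a))) ∑W≡20s)
  where
    W-7-or-10 : ∀ a b → (a , b) ≢ (0F , 0F) → W a b ≡ 7 ⊎ W a b ≡ 10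
    W-7-or-10 a b ab≢0 with allowed a b ab≢0
    ... | inj₁ W≡7         = inj₁ W≡7
    ... | inj₂ (inj₁ W≡10) = inj₂ W≡10
    ... | inj₂ (inj₂ W≡12) with ≤-trans (≤-trans (≤-reflexive (sym W≡12)) (W≤s a b)) s≤11
    ...   | s≤s (s≤s (s≤s (s≤s (s≤s (s≤s (s≤s (s≤s (s≤s (s≤s (s≤s ()))))))))))
    W%3 : ∀ a b → W a b % 3 ≡ (χ≢0 a ⊔ χ≢0 b) % 3
    W%3 a b with pair-cases a b
    ... | inj₁ refl = cong (_% 3) W₀₀≡0
    ... | inj₂ (ab≢0 , χ≡1) with W-7-or-10 a b ab≢0
    ...   | inj₁ W≡7  rewrite W≡7  | χ≡1 = refl
    ...   | inj₂ W≡10 rewrite W≡10 | χ≡1 = refl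
    s≤9 : s ≤ 9
    s≤9 = ≤11⇒[20*s]%3≡0⇒≤9 s≤11 (trans (cong (_% 3) (sym ∑W≡20s))
      (sum-cong-mod 3 (λ a → ∑[ b < 5 ] W a b) (λ a → ∑[ b < 5 ] (χ≢0 a ⊔ χ≢0 b))
        λ a → sum-cong-mod 3 (W a) (λ b → χ≢0 a ⊔ χ≢0 b) (W%3 a)))
    W≡7χ : ∀ a b → W a b ≡ 7 * (χ≢0 a ⊔ χ≢0 b)
    W≡7χ a b with pair-cases a b
    ... | inj₁ refl = W₀₀≡0
    ... | inj₂ (ab≢0 , χ≡1) with W-7-or-10 a b ab≢0
    ...   | inj₁ W≡7 rewrite χ≡1 = W≡7
    ...   | inj₂ W≡10 with ≤-trans (≤-trans (≤-reflexive (sym W≡10)) (W≤s a b)) s≤9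
    ...     | s≤s (s≤s (s≤s (s≤s (s≤s (s≤s (s≤s (s≤s (s≤s ()))))))))

proposition2 : (C : LinearCode 13 4) →
    ¬ (∀ x → LinearCode._∈C C x → ¬ (x ≈W zeroW) →
         (weight x ≡ 7) ⊎ (weight x ≡ 10) ⊎ (weight x ≡ 12))
proposition2 C allowed =
  weights-7-10-12-impossible W (jointSupportSize u) s≤11 refl W-allowed (weight-plane-≤ u) (∑∑weight-plane u)
  where
    open LinearCode C
    first  = eliminate basis fzero
    second = eliminate (reduced first) (fsuc fzero)
    u : Fin 2 → Word 13
    u = reduced second
    u≼basis : u ≼ basis
    u≼basis = ≼-trans (reduced≼ second) (reduced≼ first)
    s≤11 : jointSupportSize u ≤ 11
    s≤11 = jointSupportSize-≤ u (≼-vanishing (reduced≼ second) (reduced-vanishes first)) (reduced-vanishes second)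
    W : F₅ → F₅ → ℕ
    W a b = weight (plane u a b)
    W-allowed : ∀ a b → (a , b) ≢ (0F , 0F) → W a b ≡ 7 ⊎ W a b ≡ 10 ⊎ W a b ≡ 12
    W-allowed a b ab≢0 = allowed (plane u a b)
      (lincomb-∈ C 2 (a ∷ b ∷ []) u (≼-∈ C u≼basis basis∈))
      (plane-≉0 {u = u} (≼-independent u≼basis basis-indep) ab≢0)
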